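{- Let $q$ be a prime power, $E=\mathbb{F}_q^n$, and let $\Delta$ be a pure $q$-complex on $E$ of dimension $r$ with facets listed as $F_1,\dots,F_t$. Then $F_1,\dots,F_t$ is a shelling of $\Delta$ if and only if for all integers $1\le i<j\le t$ there exists a positive integer $k<j$ such that $F_i\cap F_j\subseteq F_k\cap F_j$ and $\dim(F_k\cap F_j)=r-1$.
   Context: A $q$-complex on $E$ is a set $\Delta$ of $\mathbb{F}_q$-subspaces of $E$ such that every subspace of a member of $\Delta$ is in $\Delta$. Elements are faces; inclusion-maximal faces are facets; $\dim\Delta=\max\{\dim A:A\in\Delta\}$; $\Delta$ is pure if all facets have the same dimension. For a set $\mathcal{A}$ of subspaces, $\langle\mathcal{A}\rangle$ (the $q$-complex generated by $\mathcal{A}$) is the set of all subspaces contained in some member of $\mathcal{A}$. A shelling of a pure $q$-complex $\Delta$ is a linear ordering $F_1,\dots,F_t$ of its facets such that for each $j=2,\dots,t$, the complex $\langle F_j\rangle\cap\langle F_1,\dots,F_{j-1}\rangle$ is generated by a nonempty set of maximal proper faces of $F_j$ (i.e. subspaces of $F_j$ of dimension $\dim F_j-1$). -}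

module Defs where

open import Level using (Level; Lift; lift; 0ℓ) renaming (suc to lsuc)
open import Data.Nat using (ℕ; zero; suc; _^_; _<_; _∸_)
open import Data.Nat.Primality using (Prime)
open import Data.Fin using (Fin; toℕ)
import Data.Fin
import Data.Nat
open import Data.Vec using (Vec; zipWith; map; replicate)
open import Data.Product using (Σ; ∃; ∃₂; _×_; _,_)
open import Relation.Binary.PropositionalEquality using (_≡_; _≢_)
open import Algebra.Structures using (IsCommutativeRing)
open import Function.Bundles using (_↔_)

IsPrimePower : ℕ → Set
IsPrimePower q = ∃₂ λ p m → Prime p × q ≡ p ^ suc m

record FiniteField (q : ℕ) : Set₁ where
  infixl 6 _+_
  infixl 7 _*_
  field
    Carrier : Set
    _+_ _*_ : Carrier → Carrier → Carrier
    -_ : Carrier → Carrier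
    0# 1# : Carrier
    isCommutativeRing : IsCommutativeRing _≡_ _+_ _*_ -_ 0# 1#
    0≢1 : 0# ≢ 1#
    inverse : ∀ x → x ≢ 0# → ∃ λ y → x * y ≡ 1#
    card : Carrier ↔ Fin q

module Geometry {q : ℕ} (K : FiniteField q) (n : ℕ) where
  open FiniteField K

  E : Set
  E = Vec Carrier n

  _⊕_ : E → E → E
  u ⊕ v = zipWith _+_ u v

  _·_ : Carrier → E → E
  c · v = map (c *_) v

  𝟎 : E
  𝟎 = replicate n 0#

  lincomb : {d : ℕ} → (Fin d → Carrier) → (Fin d → E) → E
  lincomb {zero} c b = 𝟎
  lincomb {suc d} c b = (c Data.Fin.zero · b Data.Fin.zero) ⊕ lincomb (λ i → c (Data.Fin.suc i)) (λ i → b (Data.Fin.suc i))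


  record Subspace : Set₁ where
    field
      _∈S : E → Set
      zero∈ : 𝟎 ∈S
      +-closed : ∀ {u v} → u ∈S → v ∈S → (u ⊕ v) ∈S
      ·-closed : ∀ c {v} → v ∈S → (c · v) ∈S
  open Subspace public

  _∈_ : E → Subspace → Set
  v ∈ A = (A ∈S) v

  _⊆_ : Subspace → Subspace → Set
  A ⊆ B = ∀ v → v ∈ A → v ∈ B

  _≐_ : Subspace → Subspace → Set
  A ≐ B = (A ⊆ B) × (B ⊆ A)

  _∩_ : Subspace → Subspace → Subspace
  A ∩ B = record
    { _∈S = λ v → (v ∈ A) × (v ∈ B)
    ; zero∈ = zero∈ A , zero∈ B
    ; +-closed = λ { (a , b) (a' , b') → +-closed A a a' , +-closed B b b' }
    ; ·-closed = λ c → λ { (a , b) → ·-closed A c a , ·-closed B c b }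
    }

  LinearlyIndependent : {d : ℕ} → (Fin d → E) → Set
  LinearlyIndependent {d} b = ∀ (c : Fin d → Carrier) → lincomb c b ≡ 𝟎 → ∀ i → c i ≡ 0#

  HasDim : Subspace → ℕ → Set
  HasDim A d = Σ (Fin d → E) λ b →
    (∀ i → b i ∈ A) × LinearlyIndependent b × (∀ v → v ∈ A → ∃ λ c → v ≡ lincomb c b)

  SubspaceSet : Set₂
  SubspaceSet = Subspace → Set₁

  ⟨_⟩ : SubspaceSet → SubspaceSet
  ⟨ 𝒜 ⟩ A = Σ Subspace λ B → 𝒜 B × Lift (lsuc 0ℓ) (A ⊆ B)

  _⋂_ : SubspaceSet → SubspaceSet → SubspaceSet
  (𝒜 ⋂ ℬ) A = 𝒜 A × ℬ A

  _≋_ : SubspaceSet → SubspaceSet → Set₁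
  𝒜 ≋ ℬ = ∀ A → (𝒜 A → ℬ A) × (ℬ A → 𝒜 A)

  record QComplex : Set₂ where
    field
      face : SubspaceSet
      down-closed : ∀ A B → B ⊆ A → face A → face B
  open QComplex public

  IsFacet : QComplex → Subspace → Set₁
  IsFacet Δ A = face Δ A × (∀ B → face Δ B → A ⊆ B → B ⊆ A)

  HasDimension : QComplex → ℕ → Set₁
  HasDimension Δ r = (Σ Subspace λ A → face Δ A × Lift (lsuc 0ℓ) (HasDim A r))
                   × (∀ A d → face Δ A → HasDim A d → Lift (lsuc 0ℓ) (d Data.Nat.≤ r))

  PureOfDim : QComplex → ℕ → Set₁
  PureOfDim Δ r = HasDimension Δ r × (∀ A → IsFacet Δ A → Lift (lsuc 0ℓ) (HasDim A r))

  -- F_1,…,F_t (here F 0,…,F (t-1)) is a listing of the facets of Δ, without repetition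
  FacetListing : QComplex → (t : ℕ) → (Fin t → Subspace) → Set₁
  FacetListing Δ t F = (∀ i → IsFacet Δ (F i))
                     × (∀ A → IsFacet Δ A → Lift (lsuc 0ℓ) (∃ λ i → A ≐ F i))
                     × (∀ i j → F i ≐ F j → Lift (lsuc 0ℓ) (i ≡ j))

  -- shelling (pure q-complex): for j = 2..t, ⟨F_j⟩ ∩ ⟨F_1,…,F_{j-1}⟩ is generated by a
  -- nonempty set of maximal proper faces of F_j
  IsShelling : QComplex → (t : ℕ) → (Fin t → Subspace) → Set₂
  IsShelling Δ t F = FacetListing Δ t F ×
    (∀ (j : Fin t) → 0 < toℕ j →
      Σ SubspaceSet λ 𝒢 →
        (Σ Subspace 𝒢)
        × (∀ G → 𝒢 G → Lift (lsuc 0ℓ) ((G ⊆ F j) × ∃ λ d → HasDim (F j) (suc d) × HasDim G d))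
        × (⟨ 𝒢 ⟩ ≋ (⟨ (λ B → Lift (lsuc 0ℓ) (B ≐ F j)) ⟩ ⋂ ⟨ (λ B → Lift (lsuc 0ℓ) (∃ λ k → toℕ k < toℕ j × B ≐ F k)) ⟩)))

-- In a pure complex of dimension r, let G be one of the maximal proper faces of F_j that
-- generate ⟨F_j⟩ ∩ ⟨F_1,…,F_{j-1}⟩.  Then G lies in some earlier F_k and in F_j, so
-- G ⊆ F_k ∩ F_j ⊊ F_j; since G has codimension one in F_j, G = F_k ∩ F_j, which has
-- dimension r - 1 and contains F_i ∩ F_j.  Conversely, if the condition holds, the faces
-- F_k ∩ F_j (k < j) of dimension r - 1 generate ⟨F_j⟩ ∩ ⟨F_1,…,F_{j-1}⟩.  Constructively,
-- the codimension-one step needs membership in a span to be decidable, which holds because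
-- F_q is finite.
module Submission where

open import Defs
open import Data.Nat using (ℕ; _<_; _∸_)
open import Data.Fin using (Fin; toℕ)
open import Data.Product using (∃; _×_)
open import Function.Bundles using (_⇔_)

open import Level using (Lift; lift; lower; 0ℓ) renaming (suc to lsuc)
open import Data.Nat using (zero; suc; _≤_; z≤n; s≤s)
import Data.Nat.Properties as ℕ
open import Data.Fin using (zero; suc; punchIn)
import Data.Fin.Properties as Finₚ
open import Data.Vec as V using (Vec; zipWith; map; replicate)
open import Data.Vec.Properties
  using (≡-dec; ∷-injectiveˡ; ∷-injectiveʳ; map-cong; map-∘; map-id; map-const; map-replicate)
open import Data.Vec.Relation.Binary.Pointwise.Inductive
  using (Pointwise-≡⇒≡; zipWith-comm; zipWith-identityˡ)
import Data.Vec.Functional as Vector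
open import Data.Vec.Functional.Properties using (insertAt-lookup; insertAt-punchIn)
open import Data.Product using (_,_; proj₁; proj₂)
open import Data.Empty using (⊥-elim)
open import Function.Base using (_∘_; const)
open import Relation.Nullary using (¬_; Dec; yes; no; ¬?)
open import Relation.Nullary.Decidable using (map′; via-injection; decidable-stable)
open import Relation.Binary.Definitions using (DecidableEquality)
open import Relation.Binary.PropositionalEquality
open import Function.Bundles using (mk⇔; Inverse)
open import Function.Properties.Inverse using (↔⇒↣)
open import Algebra.Bundles using (CommutativeRing)

module FiniteFieldProperties {q : ℕ} (K : FiniteField q) where
  open FiniteField K
  open Vector using (Vector; _∷_; head; tail)

  commutativeRing : CommutativeRing 0ℓ 0ℓ
  commutativeRing = record { isCommutativeRing = isCommutativeRing }

  infix 4 _≟_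
  _≟_ : DecidableEquality Carrier
  _≟_ = via-injection (↔⇒↣ card) Finₚ._≟_

  ∃? : {P : Carrier → Set} → (∀ x → Dec (P x)) → Dec (∃ P)
  ∃? {P} P? = map′ (λ (i , p) → from i , p) (λ (x , p) → to x , subst P (sym (strictlyInverseʳ x)) p)
                   (Finₚ.any? (P? ∘ from))
    where open Inverse card

  -- Without function extensionality, the predicate must be invariant under pointwise equality.
  ∃-Vector? : ∀ d {P : Vector Carrier d → Set} → (∀ {c c'} → c ≗ c' → P c → P c') →
              (∀ c → Dec (P c)) → Dec (∃ P)
  ∃-Vector? zero resp P? with P? (λ ())
  ... | yes p = yes (_ , p)
  ... | no ¬p = no (λ (c , p) → ¬p (resp (λ ()) p))
  ∃-Vector? (suc d) {P} resp P?
    with ∃? (λ x → ∃-Vector? d (λ c≗c' → resp (λ { zero → refl ; (suc i) → c≗c' i }))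
                                (λ c → P? (x ∷ c)))
  ... | yes (x , c , p) = yes (x ∷ c , p)
  ... | no ¬p = no (λ (c , p) → ¬p (head c , tail c , resp (λ { zero → refl ; (suc i) → refl }) p))

module CoordinateVectors {q : ℕ} (K : FiniteField q) where
  open FiniteField K
  open FiniteFieldProperties K
  open CommutativeRing commutativeRing
    using (ring; +-commutativeSemigroup; +-comm; +-identityˡ; *-assoc; *-identityˡ;
           distribˡ; distribʳ; zeroˡ; zeroʳ)
  open import Algebra.Properties.Ring ring using (+-inverseˡ-unique; -1*x≈-x)
  open import Algebra.Properties.CommutativeSemigroup +-commutativeSemigroup
    using (interchange; x∙yz≈y∙xz)
  open V using ([]; _∷_)

  private variable m : ℕ

  _⊕_ : Vec Carrier m → Vec Carrier m → Vec Carrier m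
  u ⊕ v = zipWith _+_ u v

  _·_ : Carrier → Vec Carrier m → Vec Carrier m
  a · v = map (a *_) v

  𝟎 : Vec Carrier m
  𝟎 = replicate _ 0#

  ⊕-comm : (u v : Vec Carrier m) → u ⊕ v ≡ v ⊕ u
  ⊕-comm u v = Pointwise-≡⇒≡ (zipWith-comm +-comm u v)

  ⊕-identityˡ : (u : Vec Carrier m) → 𝟎 ⊕ u ≡ u
  ⊕-identityˡ u = Pointwise-≡⇒≡ (zipWith-identityˡ +-identityˡ u)

  ⊕-interchange : (u v w x : Vec Carrier m) → (u ⊕ v) ⊕ (w ⊕ x) ≡ (u ⊕ w) ⊕ (v ⊕ x)
  ⊕-interchange [] [] [] [] = refl
  ⊕-interchange (a ∷ u) (b ∷ v) (c ∷ w) (e ∷ x) =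
    cong₂ _∷_ (interchange a b c e) (⊕-interchange u v w x)

  u⊕[v⊕w]≡v⊕[u⊕w] : (u v w : Vec Carrier m) → u ⊕ (v ⊕ w) ≡ v ⊕ (u ⊕ w)
  u⊕[v⊕w]≡v⊕[u⊕w] [] [] [] = refl
  u⊕[v⊕w]≡v⊕[u⊕w] (a ∷ u) (b ∷ v) (c ∷ w) =
    cong₂ _∷_ (x∙yz≈y∙xz a b c) (u⊕[v⊕w]≡v⊕[u⊕w] u v w)

  ·-distribˡ-⊕ : ∀ a (u v : Vec Carrier m) → a · (u ⊕ v) ≡ (a · u) ⊕ (a · v)
  ·-distribˡ-⊕ a [] [] = refl
  ·-distribˡ-⊕ a (x ∷ u) (y ∷ v) = cong₂ _∷_ (distribˡ a x y) (·-distribˡ-⊕ a u v)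

  ·-distribʳ-+ : ∀ a b (v : Vec Carrier m) → (a + b) · v ≡ (a · v) ⊕ (b · v)
  ·-distribʳ-+ a b [] = refl
  ·-distribʳ-+ a b (x ∷ v) = cong₂ _∷_ (distribʳ x a b) (·-distribʳ-+ a b v)

  ·-assoc : ∀ a b (v : Vec Carrier m) → (a * b) · v ≡ a · (b · v)
  ·-assoc a b v = trans (map-cong (*-assoc a b) v) (map-∘ (a *_) (b *_) v)

  ·-identityˡ : (v : Vec Carrier m) → 1# · v ≡ v
  ·-identityˡ v = trans (map-cong *-identityˡ v) (map-id v)

  ·-zeroˡ : (v : Vec Carrier m) → 0# · v ≡ 𝟎
  ·-zeroˡ v = trans (map-cong zeroˡ v) (map-const v 0#)

  ·-zeroʳ : ∀ a → a · 𝟎 {m} ≡ 𝟎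
  ·-zeroʳ {m} a = trans (map-replicate (a *_) 0# m) (cong (replicate m) (zeroʳ a))

  ⊕-inverseˡ-unique : (u v : Vec Carrier m) → u ⊕ v ≡ 𝟎 → u ≡ (- 1#) · v
  ⊕-inverseˡ-unique [] [] _ = refl
  ⊕-inverseˡ-unique (x ∷ u) (y ∷ v) eq =
    cong₂ _∷_ (trans (+-inverseˡ-unique x y (∷-injectiveˡ eq)) (sym (-1*x≈-x y)))
              (⊕-inverseˡ-unique u v (∷-injectiveʳ eq))

module LinearAlgebra {q : ℕ} (K : FiniteField q) (n : ℕ) where
  open FiniteField K
  open FiniteFieldProperties K
  open CommutativeRing commutativeRing using (*-assoc; *-comm; *-identityʳ; -‿inverseʳ)
  open import Algebra.Definitions.RawMonoid (CommutativeRing.+-rawMonoid commutativeRing) using (sum)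
  open CoordinateVectors K hiding (_⊕_; _·_; 𝟎)
  open Geometry K n
  open Vector using (_∷_; head; tail; insertAt; removeAt)

  private variable
    d m p : ℕ

  ⊆-refl : ∀ A → A ⊆ A
  ⊆-refl _ _ v∈ = v∈

  ≐-refl : ∀ A → A ≐ A
  ≐-refl A = ⊆-refl A , ⊆-refl A

  lincomb-cong : {c c' : Fin d → Carrier} (b : Fin d → E) → c ≗ c' → lincomb c b ≡ lincomb c' b
  lincomb-cong {zero} b c≗c' = refl
  lincomb-cong {suc d} b c≗c' =
    cong₂ _⊕_ (cong (_· b zero) (c≗c' zero)) (lincomb-cong (tail b) (c≗c' ∘ suc))

  lincomb-0 : (b : Fin d → E) → lincomb (const 0#) b ≡ 𝟎
  lincomb-0 {zero} b = refl
  lincomb-0 {suc d} b = trans (cong₂ _⊕_ (·-zeroˡ (b zero)) (lincomb-0 (tail b))) (⊕-identityˡ 𝟎)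

  lincomb-+ : (c c' : Fin d → Carrier) (b : Fin d → E) →
              lincomb (λ i → c i + c' i) b ≡ lincomb c b ⊕ lincomb c' b
  lincomb-+ {zero} c c' b = sym (⊕-identityˡ 𝟎)
  lincomb-+ {suc d} c c' b =
    trans (cong₂ _⊕_ (·-distribʳ-+ (c zero) (c' zero) (b zero)) (lincomb-+ (tail c) (tail c') (tail b)))
          (⊕-interchange _ _ _ _)

  lincomb-* : ∀ a (c : Fin d → Carrier) (b : Fin d → E) → lincomb (λ i → a * c i) b ≡ a · lincomb c b
  lincomb-* {zero} a c b = sym (·-zeroʳ a)
  lincomb-* {suc d} a c b =
    trans (cong₂ _⊕_ (·-assoc a (c zero) (b zero)) (lincomb-* a (tail c) (tail b)))
          (sym (·-distribˡ-⊕ a _ _))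

  lincomb-⊕ : (c : Fin d → Carrier) (x y : Fin d → E) →
              lincomb c (λ i → x i ⊕ y i) ≡ lincomb c x ⊕ lincomb c y
  lincomb-⊕ {zero} c x y = sym (⊕-identityˡ 𝟎)
  lincomb-⊕ {suc d} c x y =
    trans (cong₂ _⊕_ (·-distribˡ-⊕ (c zero) (x zero) (y zero)) (lincomb-⊕ (tail c) (tail x) (tail y)))
          (⊕-interchange _ _ _ _)

  lincomb-· : (c β : Fin d → Carrier) (y : E) → lincomb c (λ i → β i · y) ≡ sum (λ i → c i * β i) · y
  lincomb-· {zero} c β y = sym (·-zeroˡ y)
  lincomb-· {suc d} c β y =
    trans (cong₂ _⊕_ (sym (·-assoc (c zero) (β zero) y)) (lincomb-· (tail c) (tail β) y))
          (sym (·-distribʳ-+ _ _ y))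

  lincomb-head-zero : (c : Fin (suc d) → Carrier) (b : Fin (suc d) → E) → head c ≡ 0# →
                      lincomb c b ≡ lincomb (tail c) (tail b)
  lincomb-head-zero c b c₀≡0 = begin
    (head c · head b) ⊕ L ≡⟨ cong (λ a → (a · head b) ⊕ L) c₀≡0 ⟩
    (0# · head b) ⊕ L     ≡⟨ cong (_⊕ L) (·-zeroˡ (head b)) ⟩
    𝟎 ⊕ L                 ≡⟨ ⊕-identityˡ L ⟩
    L                     ∎
    where
    open ≡-Reasoning
    L = lincomb (tail c) (tail b)

  lincomb-removeAt : (i : Fin (suc m)) (c : Fin (suc m) → Carrier) (u : Fin (suc m) → E) →
                     lincomb c u ≡ (c i · u i) ⊕ lincomb (removeAt c i) (removeAt u i)
  lincomb-removeAt zero c u = refl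
  lincomb-removeAt {suc m} (suc i) c u =
    trans (cong ((c zero · u zero) ⊕_) (lincomb-removeAt i (tail c) (tail u)))
          (u⊕[v⊕w]≡v⊕[u⊕w] _ _ _)

  lincomb-∈ : ∀ S (c : Fin d → Carrier) (b : Fin d → E) → (∀ i → b i ∈ S) → lincomb c b ∈ S
  lincomb-∈ {zero} S c b b∈S = zero∈ S
  lincomb-∈ {suc d} S c b b∈S =
    +-closed S (·-closed S (c zero) (b∈S zero)) (lincomb-∈ S (tail c) (tail b) (b∈S ∘ suc))

  span : (Fin d → E) → Subspace
  span w = record
    { _∈S = λ v → ∃ λ c → v ≡ lincomb c w
    ; zero∈ = const 0# , sym (lincomb-0 w)
    ; +-closed = λ (c , u≡) (c' , v≡) →
        (λ i → c i + c' i) , trans (cong₂ _⊕_ u≡ v≡) (sym (lincomb-+ c c' w))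
    ; ·-closed = λ a (c , v≡) → (λ i → a * c i) , trans (cong (a ·_) v≡) (sym (lincomb-* a c w))
    }

  span-⊆ : ∀ S (w : Fin d → E) → (∀ i → w i ∈ S) → span w ⊆ S
  span-⊆ S w w∈S v (c , v≡) = subst (_∈ S) (sym v≡) (lincomb-∈ S c w w∈S)

  ∈-∷ : ∀ S {x : E} {b : Fin d → E} → x ∈ S → (∀ i → b i ∈ S) → ∀ i → (x ∷ b) i ∈ S
  ∈-∷ S x∈S b∈S zero = x∈S
  ∈-∷ S x∈S b∈S (suc i) = b∈S i

  ∈-span-tail : (w : Fin (suc d) → E) {v : E} (v∈ : v ∈ span w) → head (proj₁ v∈) ≡ 0# →
                v ∈ span (tail w)
  ∈-span-tail w (c , v≡) c₀≡0 = tail c , trans v≡ (lincomb-head-zero c w c₀≡0)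

  ∈-span? : (v : E) (w : Fin d → E) → Dec (v ∈ span w)
  ∈-span? {d} v w = ∃-Vector? d (λ c≗c' v≡ → trans v≡ (lincomb-cong w c≗c'))
                                (λ c → ≡-dec _≟_ v (lincomb c w))

  extend-independent : (x : E) (b : Fin d → E) → LinearlyIndependent b → ¬ (x ∈ span b) →
                       LinearlyIndependent (x ∷ b)
  extend-independent x b ind x∉ c lincomb≡𝟎 with head c ≟ 0#
  ... | yes c₀≡0 = λ { zero → c₀≡0 ; (suc i) → ind (tail c) tail≡𝟎 i }
    where
    tail≡𝟎 : lincomb (tail c) b ≡ 𝟎
    tail≡𝟎 = trans (sym (lincomb-head-zero c (x ∷ b) c₀≡0)) lincomb≡𝟎
  ... | no c₀≢0 = ⊥-elim (x∉ x∈span)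
    where
    open ≡-Reasoning
    α = proj₁ (inverse (head c) c₀≢0)
    α*c₀≡1 : α * head c ≡ 1#
    α*c₀≡1 = trans (*-comm α (head c)) (proj₂ (inverse (head c) c₀≢0))
    x≡ : x ≡ (α * - 1#) · lincomb (tail c) b
    x≡ = begin
      x                                   ≡⟨ sym (·-identityˡ x) ⟩
      1# · x                              ≡⟨ cong (_· x) (sym α*c₀≡1) ⟩
      (α * head c) · x                    ≡⟨ ·-assoc α (head c) x ⟩
      α · (head c · x)                    ≡⟨ cong (α ·_) (⊕-inverseˡ-unique _ _ lincomb≡𝟎) ⟩
      α · ((- 1#) · lincomb (tail c) b)   ≡⟨ sym (·-assoc α (- 1#) _) ⟩
      (α * - 1#) · lincomb (tail c) b     ∎
    x∈span : x ∈ span b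
    x∈span = subst (_∈ span b) (sym x≡) (·-closed (span b) (α * - 1#) (tail c , refl))

  shear-independent : (u : Fin (suc m) → E) → LinearlyIndependent u → (i : Fin (suc m))
                      (β : Fin m → Carrier) → LinearlyIndependent (λ k → u (punchIn i k) ⊕ (β k · u i))
  shear-independent u ind i β c lincomb≡𝟎 k = begin
    c k                ≡⟨ sym (insertAt-punchIn c i s k) ⟩
    c'' (punchIn i k)  ≡⟨ ind c'' lincomb-c''≡𝟎 (punchIn i k) ⟩
    0#                 ∎
    where
    open ≡-Reasoning
    s = sum (λ k → c k * β k)
    c'' = insertAt c i s
    lincomb-c''≡𝟎 : lincomb c'' u ≡ 𝟎
    lincomb-c''≡𝟎 = begin
      lincomb c'' u                                           ≡⟨ lincomb-removeAt i c'' u ⟩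
      (c'' i · u i) ⊕ lincomb (removeAt c'' i) (removeAt u i) ≡⟨ cong₂ (λ a v → (a · u i) ⊕ v)
                                                                  (insertAt-lookup c i s)
                                                                  (lincomb-cong (removeAt u i) (insertAt-punchIn c i s)) ⟩
      (s · u i) ⊕ lincomb c (removeAt u i)                    ≡⟨ ⊕-comm _ _ ⟩
      lincomb c (removeAt u i) ⊕ (s · u i)                    ≡⟨ cong (_ ⊕_) (sym (lincomb-· c β (u i))) ⟩
      lincomb c (removeAt u i) ⊕ lincomb c (λ k → β k · u i)  ≡⟨ sym (lincomb-⊕ c (removeAt u i) _) ⟩
      lincomb c (λ k → u (punchIn i k) ⊕ (β k · u i))         ≡⟨ lincomb≡𝟎 ⟩
      𝟎                                                       ∎

  -- Steinitz elimination: drop the first spanning vector w₀, after clearing its coefficient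
  -- from all but one of the u's by subtracting multiples of a u whose w₀-coefficient is nonzero.
  independent-in-span⇒≤ : (w : Fin p → E) (u : Fin m → E) → (∀ i → u i ∈ span w) →
                          LinearlyIndependent u → m ≤ p
  independent-in-span⇒≤ {zero} {zero} w u u∈ ind = z≤n
  independent-in-span⇒≤ {zero} {suc m} w u u∈ ind =
    ⊥-elim (0≢1 (sym (ind (const 1#) (proj₂ (lincomb-∈ (span w) (const 1#) u u∈)) zero)))
  independent-in-span⇒≤ {suc p} {zero} w u u∈ ind = z≤n
  independent-in-span⇒≤ {suc p} {suc m} w u u∈ ind
    with Finₚ.any? (λ i → ¬? (head (proj₁ (u∈ i)) ≟ 0#))
  ... | yes (i , aᵢ≢0) =
    s≤s (independent-in-span⇒≤ (tail w) _ sheared∈ (shear-independent u ind i β))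
    where
    open ≡-Reasoning
    a : Fin (suc m) → Carrier
    a j = head (proj₁ (u∈ j))
    α = proj₁ (inverse (a i) aᵢ≢0)
    α*aᵢ≡1 : α * a i ≡ 1#
    α*aᵢ≡1 = trans (*-comm α (a i)) (proj₂ (inverse (a i) aᵢ≢0))
    β : Fin m → Carrier
    β k = - a (punchIn i k) * α
    cleared : ∀ k → a (punchIn i k) + β k * a i ≡ 0#
    cleared k = begin
      aₖ + (- aₖ * α) * a i   ≡⟨ cong (aₖ +_) (*-assoc (- aₖ) α (a i)) ⟩
      aₖ + - aₖ * (α * a i)   ≡⟨ cong (λ y → aₖ + - aₖ * y) α*aᵢ≡1 ⟩
      aₖ + - aₖ * 1#          ≡⟨ cong (aₖ +_) (*-identityʳ (- aₖ)) ⟩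
      aₖ + - aₖ               ≡⟨ -‿inverseʳ aₖ ⟩
      0#                      ∎
      where aₖ = a (punchIn i k)
    sheared∈ : ∀ k → (u (punchIn i k) ⊕ (β k · u i)) ∈ span (tail w)
    sheared∈ k = ∈-span-tail w
      (+-closed (span w) (u∈ (punchIn i k)) (·-closed (span w) (β k) (u∈ i))) (cleared k)
  ... | no ∄aᵢ≢0 =
    ℕ.m≤n⇒m≤1+n (independent-in-span⇒≤ (tail w) u (λ i → ∈-span-tail w (u∈ i) (aᵢ≡0 i)) ind)
    where
    aᵢ≡0 : ∀ i → head (proj₁ (u∈ i)) ≡ 0#
    aᵢ≡0 i = decidable-stable (_ ≟ 0#) (λ aᵢ≢0 → ∄aᵢ≢0 (i , aᵢ≢0))

  independent-in-subspace⇒≤ : ∀ A → HasDim A d → (u : Fin m → E) → (∀ i → u i ∈ A) →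
                              LinearlyIndependent u → m ≤ d
  independent-in-subspace⇒≤ A (b , _ , _ , A⊆span) u u∈A =
    independent-in-span⇒≤ b u (λ i → A⊆span _ (u∈A i))

  hasDim-unique : ∀ A → HasDim A d → HasDim A m → d ≡ m
  hasDim-unique A dimA@(b , b∈A , ind , _) dimA'@(b' , b'∈A , ind' , _) =
    ℕ.≤-antisym (independent-in-subspace⇒≤ A dimA' b b∈A ind)
                (independent-in-subspace⇒≤ A dimA b' b'∈A ind')

  hasDim-resp-≐ : ∀ A B → A ≐ B → HasDim A d → HasDim B d
  hasDim-resp-≐ A B (A⊆B , B⊆A) (b , b∈A , ind , A⊆span) =
    b , (λ i → A⊆B _ (b∈A i)) , ind , (λ v → A⊆span v ∘ B⊆A v)

  hasDim-zero⇒⊆ : ∀ A B → HasDim A 0 → A ⊆ B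
  hasDim-zero⇒⊆ A B (_ , _ , _ , A⊆span) v v∈A = subst (_∈ B) (sym (proj₂ (A⊆span v v∈A))) (zero∈ B)

  hasDim-suc∸1 : ∀ A B → HasDim A d → ¬ (A ⊆ B) → HasDim A (suc (d ∸ 1))
  hasDim-suc∸1 {d = zero} A B dimA A⊈B = ⊥-elim (A⊈B (hasDim-zero⇒⊆ A B dimA))
  hasDim-suc∸1 {d = suc d} A B dimA _ = dimA

  -- If some v ∈ H lay outside G, then v together with a basis of G would span A ⊆ H,
  -- as any vector of A outside that span would give d + 2 independent vectors in A.
  codimOne-maximal : ∀ G H A → G ⊆ H → H ⊆ A → HasDim G d → HasDim A (suc d) → ¬ (A ⊆ H) → H ⊆ G
  codimOne-maximal G H A G⊆H H⊆A (b , b∈G , ind , G⊆span) dimA A⊈H v v∈H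
    with ∈-span? v b
  ... | yes v∈span = span-⊆ G b b∈G v v∈span
  ... | no v∉span = ⊥-elim (A⊈H A⊆H)
    where
    b∈A : ∀ i → b i ∈ A
    b∈A i = H⊆A _ (G⊆H _ (b∈G i))
    A⊆H : A ⊆ H
    A⊆H w w∈A with ∈-span? w (v ∷ b)
    ... | yes w∈span = span-⊆ H (v ∷ b) (∈-∷ H v∈H (λ i → G⊆H _ (b∈G i))) w w∈span
    ... | no w∉span = ⊥-elim (ℕ.1+n≰n (independent-in-subspace⇒≤ A dimA (w ∷ v ∷ b)
            (∈-∷ A w∈A (∈-∷ A (H⊆A v v∈H) b∈A))
            (extend-independent w (v ∷ b) (extend-independent v b ind v∉span) w∉span)))

module Shelling {q : ℕ} (K : FiniteField q) (n : ℕ) where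
  open Geometry K n
  open LinearAlgebra K n

  ｛_｝ : Subspace → SubspaceSet
  ｛ A ｝ B = Lift (lsuc 0ℓ) (B ≐ A)

  module _ (Δ : QComplex) (r : ℕ) (pure : PureOfDim Δ r)
           (t : ℕ) (F : Fin t → Subspace) (listing : FacetListing Δ t F) where

    private variable
      d : ℕ
      i j k : Fin t

    EarlierFacet : Fin t → SubspaceSet
    EarlierFacet j B = Lift (lsuc 0ℓ) (∃ λ k → toℕ k < toℕ j × B ≐ F k)

    EarlierRidge : Fin t → SubspaceSet
    EarlierRidge j G = Lift (lsuc 0ℓ)
      (∃ λ k → toℕ k < toℕ j × G ≐ (F k ∩ F j) × HasDim (F k ∩ F j) (r ∸ 1))

    RidgeCondition : Set
    RidgeCondition = ∀ i j → toℕ i < toℕ j →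
      ∃ λ k → toℕ k < toℕ j × (F i ∩ F j) ⊆ (F k ∩ F j) × HasDim (F k ∩ F j) (r ∸ 1)

    facet-dim : ∀ j → HasDim (F j) r
    facet-dim j = lower (proj₂ pure (F j) (proj₁ listing j))

    earlier-facet-⊉ : toℕ k < toℕ j → ¬ (F j ⊆ F k)
    earlier-facet-⊉ {k} {j} k<j Fj⊆Fk =
      ℕ.>⇒≢ k<j (cong toℕ (lower (proj₂ (proj₂ listing) j k (Fj⊆Fk , Fk⊆Fj))))
      where
      Fk⊆Fj : F k ⊆ F j
      Fk⊆Fj = proj₂ (proj₁ listing j) (F k) (proj₁ (proj₁ listing k)) Fj⊆Fk

    codimOne-in-earlier-facet : ∀ G → toℕ k < toℕ j → G ⊆ F k → G ⊆ F j →
                                HasDim (F j) (suc d) → HasDim G d → G ≐ (F k ∩ F j)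
    codimOne-in-earlier-facet {k} {j} G k<j G⊆Fk G⊆Fj dimFj dimG = G⊆H , H⊆G
      where
      G⊆H = λ v v∈G → G⊆Fk v v∈G , G⊆Fj v v∈G
      H⊆G = codimOne-maximal G (F k ∩ F j) (F j) G⊆H (λ _ → proj₂) dimG dimFj
                             (λ Fj⊆H → earlier-facet-⊉ k<j (λ v → proj₁ ∘ Fj⊆H v))

    shelling⇒ridgeCondition : IsShelling Δ t F → RidgeCondition
    shelling⇒ridgeCondition (_ , shelling) i j i<j
      with shelling j (ℕ.≤-<-trans z≤n i<j)
    ... | 𝒢 , _ , 𝒢-codimOne , 𝒢≋
      with proj₂ (𝒢≋ (F i ∩ F j)) ((F j , lift (≐-refl (F j)) , lift (λ _ → proj₂)) ,
                                    (F i , lift (i , i<j , ≐-refl (F i)) , lift (λ _ → proj₁)))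
    ... | G , G∈𝒢 , lift Fi∩Fj⊆G
      with lower (𝒢-codimOne G G∈𝒢) | proj₂ (proj₁ (𝒢≋ G) (G , G∈𝒢 , lift (⊆-refl G)))
    ... | G⊆Fj , d , dimFj , dimG | _ , lift (k , k<j , B⊆Fk , _) , lift G⊆B =
      k , k<j , (λ v → G⊆H v ∘ Fi∩Fj⊆G v) ,
      subst (HasDim (F k ∩ F j)) d≡r∸1 (hasDim-resp-≐ G (F k ∩ F j) G≐H dimG)
      where
      G≐H = codimOne-in-earlier-facet G k<j (λ v → B⊆Fk v ∘ G⊆B v) G⊆Fj dimFj dimG
      G⊆H = proj₁ G≐H
      d≡r∸1 = cong (_∸ 1) (hasDim-unique (F j) dimFj (facet-dim j))

    earlierRidge-codimOne : toℕ k < toℕ j → ∀ G → EarlierRidge j G →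
      Lift (lsuc 0ℓ) ((G ⊆ F j) × ∃ λ d → HasDim (F j) (suc d) × HasDim G d)
    earlierRidge-codimOne {k} {j} k<j G (lift (k' , _ , (G⊆H , H⊆G) , dimH)) =
      lift ((λ v → proj₂ ∘ G⊆H v) , r ∸ 1 ,
            hasDim-suc∸1 (F j) (F k) (facet-dim j) (earlier-facet-⊉ k<j) ,
            hasDim-resp-≐ (F k' ∩ F j) G (H⊆G , G⊆H) dimH)

    ridgeCondition⇒shelling : RidgeCondition → IsShelling Δ t F
    ridgeCondition⇒shelling condition = listing , λ j 0<j →
      let (i , i<j) = earlier-exists j 0<j
          (k , k<j , _ , dimH) = condition i j i<j
      in EarlierRidge j , (F k ∩ F j , lift (k , k<j , ≐-refl (F k ∩ F j) , dimH)) ,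
         earlierRidge-codimOne k<j , λ A → to j A , from j A
      where
      earlier-exists : ∀ {t} (j : Fin t) → 0 < toℕ j → ∃ λ (i : Fin t) → toℕ i < toℕ j
      earlier-exists (suc j) _ = zero , s≤s z≤n

      to : ∀ j A → ⟨ EarlierRidge j ⟩ A → (⟨ ｛ F j ｝ ⟩ ⋂ ⟨ EarlierFacet j ⟩) A
      to j A (_ , lift (k , k<j , (B⊆H , _) , _) , lift A⊆B) =
        (F j , lift (≐-refl (F j)) , lift (λ v → proj₂ ∘ B⊆H v ∘ A⊆B v)) ,
        (F k , lift (k , k<j , ≐-refl (F k)) , lift (λ v → proj₁ ∘ B⊆H v ∘ A⊆B v))

      from : ∀ j A → (⟨ ｛ F j ｝ ⟩ ⋂ ⟨ EarlierFacet j ⟩) A → ⟨ EarlierRidge j ⟩ A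
      from j A ((_ , lift (B⊆Fj , _) , lift A⊆B) , (_ , lift (i , i<j , B'⊆Fi , _) , lift A⊆B'))
        with condition i j i<j
      ... | k , k<j , Fi∩Fj⊆H , dimH =
        F k ∩ F j , lift (k , k<j , ≐-refl (F k ∩ F j) , dimH) ,
        lift (λ v v∈A → Fi∩Fj⊆H v (B'⊆Fi v (A⊆B' v v∈A) , B⊆Fj v (A⊆B v v∈A)))

lemma4p3 : (q : ℕ) → IsPrimePower q → (K : FiniteField q) → (n : ℕ) →
    let open Geometry K n in
    (Δ : QComplex) (r : ℕ) → PureOfDim Δ r →
    (t : ℕ) (F : Fin t → Subspace) → FacetListing Δ t F →
    (IsShelling Δ t F ⇔
    (∀ (i j : Fin t) → toℕ i < toℕ j →
    ∃ λ (k : Fin t) → toℕ k < toℕ j × ((F i ∩ F j) ⊆ (F k ∩ F j)) × HasDim (F k ∩ F j) (r ∸ 1)))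
lemma4p3 q _ K n Δ r pure t F listing =
  mk⇔ (shelling⇒ridgeCondition Δ r pure t F listing) (ridgeCondition⇒shelling Δ r pure t F listing)
  where open Shelling K n
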